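{- For every shattered tournament $T$ and every integer $m\ge 2$, the graph $G_T(m)$ is $3$-existentially complete triangle-free.
   Context: A tournament is an orientation of a complete graph; an arc is written $i\to i'$. Let $T_4$ be the tournament on $\{0,1,2,3\}$ with arcs $0\to1,0\to2,0\to3,1\to2,2\to3,3\to1$, and $T_4'$ the tournament obtained by reversing all arcs of $T_4$. A tournament $T$ is \emph{shattered} if every set of three of its vertices is contained in a set of four vertices inducing a tournament isomorphic to $T_4$ or to $T_4'$. $G_T(m)$ has vertex set $\{(i,j,x): i\in V(T),\ 1\le j\le m,\ x\in\mathbb{Z}_4\}$ and edges exactly: $(i,j,x)\sim(i,j,x+1)$ for all $i,j,x$; $(i,j,x)\sim(i,j',x+2)$ for all $i,x$ and $j\ne j'$; $(i,j,x)\sim(i',j',x+3)$ for all $x,j,j'$ whenever $i\to i'$ in $T$ (addition in $\mathbb{Z}_4$; adjacency symmetric). A graph $G=(V,E)$ is \emph{$3$-existentially complete triangle-free} if it is triangle-free and for every $B\subseteq A\subseteq V$ with $|A|\le 3$ and $B$ independent, there exists a vertex $v\in V\setminus A$ adjacent to every vertex of $B$ and to no vertex of $A\setminus B$. -}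

module Defs where

open import Level using (0ℓ)
open import Data.Nat using (ℕ)
open import Data.Fin using (Fin; zero; suc)
open import Data.Product using (Σ; ∃; ∃-syntax; _×_; _,_)
open import Data.Sum using (_⊎_)
open import Data.List using (List; length)
open import Data.List.Relation.Unary.All using (All)
open import Data.List.Membership.Propositional using (_∈_; _∉_)
open import Data.Nat using (_≤_)
open import Relation.Nullary using (¬_)
open import Relation.Binary.PropositionalEquality using (_≡_; _≢_)
open import Function.Definitions using (Injective)
open import Function.Bundles using (_⇔_)

record Tournament (n : ℕ) : Set₁ where
  field
    _⇒_    : Fin n → Fin n → Set
    irrefl : ∀ i → ¬ (i ⇒ i)
    asym   : ∀ i j → i ⇒ j → ¬ (j ⇒ i)
    total  : ∀ i j → i ≢ j → (i ⇒ j) ⊎ (j ⇒ i)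

open Tournament public

data T4arc : Fin 4 → Fin 4 → Set where
  a01 : T4arc zero (suc zero)
  a02 : T4arc zero (suc (suc zero))
  a03 : T4arc zero (suc (suc (suc zero)))
  a12 : T4arc (suc zero) (suc (suc zero))
  a23 : T4arc (suc (suc zero)) (suc (suc (suc zero)))
  a31 : T4arc (suc (suc (suc zero))) (suc zero)

T4'arc : Fin 4 → Fin 4 → Set
T4'arc i j = T4arc j i

InducedCopy : ∀ {n} → Tournament n → (Fin 4 → Fin 4 → Set) → (Fin 4 → Fin n) → Set
InducedCopy T R f = Injective _≡_ _≡_ f × (∀ i j → (R i j ⇔ (_⇒_ T (f i) (f j))))

InImage : ∀ {n} → (Fin 4 → Fin n) → Fin n → Set
InImage f v = ∃[ k ] f k ≡ v

Shattered : ∀ {n} → Tournament n → Set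
Shattered {n} T =
  ∀ (x y z : Fin n) → x ≢ y → y ≢ z → x ≢ z →
  ∃[ f ] ((InducedCopy T T4arc f ⊎ InducedCopy T T4'arc f)
          × InImage f x × InImage f y × InImage f z)

inc : Fin 4 → Fin 4
inc zero = suc zero
inc (suc zero) = suc (suc zero)
inc (suc (suc zero)) = suc (suc (suc zero))
inc (suc (suc (suc zero))) = zero

plus1 plus2 plus3 : Fin 4 → Fin 4
plus1 x = inc x
plus2 x = inc (inc x)
plus3 x = inc (inc (inc x))

-- The graph G_T(m); the index j ∈ {1,…,m} is represented by Fin m.

GVertex : ℕ → ℕ → Set
GVertex n m = Fin n × Fin m × Fin 4

data GEdge {n} (T : Tournament n) (m : ℕ) : GVertex n m → GVertex n m → Set where
  e-cyc  : ∀ i j x → GEdge T m (i , j , x) (i , j , plus1 x)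
  e-anti : ∀ i j j' x → j ≢ j' → GEdge T m (i , j , x) (i , j' , plus2 x)
  e-arc  : ∀ i i' j j' x → _⇒_ T i i' → GEdge T m (i , j , x) (i' , j' , plus3 x)

GAdj : ∀ {n} (T : Tournament n) (m : ℕ) → GVertex n m → GVertex n m → Set
GAdj T m u v = GEdge T m u v ⊎ GEdge T m v u

TriangleFree : (V : Set) → (V → V → Set) → Set
TriangleFree V Adj = ∀ (u v w : V) → ¬ (Adj u v × Adj v w × Adj u w)

-- finite vertex sets A, B are given as lists (membership = set membership)
Independent : {V : Set} → (V → V → Set) → List V → Set
Independent {V} Adj B = ∀ (u v : V) → u ∈ B → v ∈ B → ¬ Adj u v

ThreeEC : (V : Set) → (V → V → Set) → Set
ThreeEC V Adj =
  ∀ (A B : List V) → length A ≤ 3 → All (_∈ A) B → Independent Adj B →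
  ∃[ v ] (v ∉ A × All (Adj v) B × (∀ a → a ∈ A → a ∉ B → ¬ Adj v a))

ThreeECTriangleFree : (V : Set) → (V → V → Set) → Set
ThreeECTriangleFree V Adj = TriangleFree V Adj × ThreeEC V Adj

-- Along an edge of G_T(m) the phase x changes by ±1, except along the edges
-- (i,j,x) ~ (i,j',x+2) joining different copies of a vertex of T; so every triangle has one
-- or three such edges, and in either case two adjacent vertices are forced to share a phase.
--
-- Adjacency in G_T(m) only depends on equalities and arcs between the T-coordinates, on
-- equality of the copies and on the phases. Hence three vertices, together with every
-- candidate witness, lie in the image of a small graph G_S(k): S is a copy of T₄ or T₄′
-- through the three T-coordinates when these are distinct (this is where shattering is
-- used) and a single arc otherwise, at most three copies are needed, and a rotation of the
-- phases puts the first vertex at phase 0. The extension property of these finitely many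
-- configurations is checked by computation and transported along the embeddings.

module Submission where

open import Defs
open import Data.Bool using (Bool; true; false; T; not; _∧_; if_then_else_)
open import Data.Bool.ListAction using (all; any)
open import Data.Bool.Properties
  using (T-≡; ∧-conicalˡ; ∧-conicalʳ; ¬-not; not-involutive) renaming (_≟_ to _≟ᴮ_)
open import Data.Empty using (⊥; ⊥-elim)
open import Data.Fin using (Fin; zero; suc; _<_)
open import Data.Fin.Patterns using (0F; 1F; 2F; 3F)
open import Data.Fin.Properties using (_≟_; <-irrefl; <-asym; <-cmp)
open import Data.List using (List; []; _∷_; length; allFin)
import Data.List.Membership.DecPropositional as DecMembership
open import Data.List.Membership.Propositional using (_∈_; _∉_)
open import Data.List.Membership.Propositional.Properties using (∈-allFin)
open import Data.List.Relation.Unary.All as All using (All)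
open import Data.List.Relation.Unary.All.Properties using (all⁻; all⁺)
open import Data.List.Relation.Unary.Any using (here; there; satisfied)
open import Data.List.Relation.Unary.Any.Properties using (any⁻)
open import Data.Nat using (ℕ; zero; suc; _≤_; s≤s; z≤n; z<s)
open import Data.Product using (Σ; ∃; _×_; _,_; proj₁; proj₂)
open import Data.Product.Properties using (≡-dec; ,-injective)
open import Data.Sum using (_⊎_; inj₁; inj₂; swap)
open import Data.Sum.Function.Propositional using (_⊎-⇔_)
open import Data.Vec using (Vec; []; _∷_; lookup; map; zipWith; replicate; _[_]≔_)
open import Data.Vec.Properties
  using (lookup-map; lookup-zipWith; lookup∘update; lookup∘update′; tabulate∘lookup)
open import Data.Vec.Relation.Unary.All using ([]; _∷_)
open import Data.Vec.Relation.Unary.AllPairs using ([]; _∷_; allPairs?)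
open import Data.Vec.Relation.Unary.Unique.Propositional using (Unique)
open import Data.Vec.Relation.Unary.Unique.Propositional.Properties using (lookup-injective; tabulate⁺)
open import Function using (_∘_; const)
open import Function.Bundles using (_⇔_; mk⇔; Equivalence)
open import Function.Construct.Composition using (_⇔-∘_)
open import Function.Construct.Symmetry using (⇔-sym)
open import Function.Definitions using (Injective)
open import Relation.Binary using (DecidableEquality; tri<; tri≈; tri>)
open import Relation.Binary.PropositionalEquality
  using (_≡_; _≢_; refl; sym; trans; cong; cong₂; subst; subst₂; ≢-sym)
open import Relation.Nullary using (¬_; Dec; yes; no; does; isYes)
open import Relation.Nullary.Decidable
  using (_×-dec_; _⊎-dec_; _→-dec_; ¬?; T?; toWitness; fromWitness; dec-true; decidable-stable)
import Relation.Nullary.Decidable as Decidable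

open Equivalence using (to; from)

private
  variable
    c k m n : ℕ

arc? : (T : Tournament n) → ∀ i i' → Dec (_⇒_ T i i')
arc? T i i' with i ≟ i'
... | yes refl = no (irrefl T i)
... | no i≢i' with total T i i' i≢i'
...   | inj₁ i⇒i' = yes i⇒i'
...   | inj₂ i'⇒i = no (asym T i' i i'⇒i)

EdgeShape : Tournament n → (m : ℕ) → GVertex n m → GVertex n m → Set
EdgeShape T m (i , j , x) (i' , j' , y) =
    (i ≡ i' × j ≡ j' × y ≡ plus1 x)
  ⊎ (i ≡ i' × j ≢ j' × y ≡ plus2 x)
  ⊎ (_⇒_ T i i' × y ≡ plus3 x)

edgeShape⇔GEdge : {T : Tournament n} → ∀ {u v} → EdgeShape T m u v ⇔ GEdge T m u v
edgeShape⇔GEdge {m = m} {T = T} = mk⇔ edge shape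
  where
  edge : ∀ {u v} → EdgeShape T m u v → GEdge T m u v
  edge {i , j , x} (inj₁ (refl , refl , refl)) = e-cyc i j x
  edge {i , j , x} {_ , j' , _} (inj₂ (inj₁ (refl , j≢j' , refl))) = e-anti i j j' x j≢j'
  edge {i , j , x} {i' , j' , _} (inj₂ (inj₂ (i⇒i' , refl))) = e-arc i i' j j' x i⇒i'
  shape : ∀ {u v} → GEdge T m u v → EdgeShape T m u v
  shape (e-cyc i j x) = inj₁ (refl , refl , refl)
  shape (e-anti i j j' x j≢j') = inj₂ (inj₁ (refl , j≢j' , refl))
  shape (e-arc i i' j j' x i⇒i') = inj₂ (inj₂ (i⇒i' , refl))

edgeShape? : (T : Tournament n) (m : ℕ) → ∀ u v → Dec (EdgeShape T m u v)
edgeShape? T m (i , j , x) (i' , j' , y) =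
        (i ≟ i' ×-dec j ≟ j' ×-dec y ≟ plus1 x)
  ⊎-dec (i ≟ i' ×-dec ¬? (j ≟ j') ×-dec y ≟ plus2 x)
  ⊎-dec (arc? T i i' ×-dec y ≟ plus3 x)

GAdj? : (T : Tournament n) (m : ℕ) → ∀ u v → Dec (GAdj T m u v)
GAdj? T m u v = edge? u v ⊎-dec edge? v u
  where
  edge? : ∀ u v → Dec (GEdge T m u v)
  edge? u v = Decidable.map (edgeShape⇔GEdge {u = u} {v}) (edgeShape? T m u v)

_≟ᵛ_ : DecidableEquality (GVertex n m)
_≟ᵛ_ = ≡-dec _≟_ (≡-dec _≟_ _≟_)

parity : Fin 4 → Bool
parity 0F = false
parity 1F = true
parity 2F = false
parity 3F = true

parity-plus1 : ∀ x → parity x ≢ parity (plus1 x)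
parity-plus1 0F ()
parity-plus1 1F ()
parity-plus1 2F ()
parity-plus1 3F ()

parity-plus2 : ∀ x → parity x ≡ parity (plus2 x)
parity-plus2 0F = refl
parity-plus2 1F = refl
parity-plus2 2F = refl
parity-plus2 3F = refl

parity-plus3 : ∀ x → parity x ≢ parity (plus3 x)
parity-plus3 0F ()
parity-plus3 1F ()
parity-plus3 2F ()
parity-plus3 3F ()

plus2-no-fixpoint : ∀ x → x ≢ plus2 x
plus2-no-fixpoint 0F ()
plus2-no-fixpoint 1F ()
plus2-no-fixpoint 2F ()
plus2-no-fixpoint 3F ()

inc⁴ : ∀ x → inc (inc (inc (inc x))) ≡ x
inc⁴ 0F = refl
inc⁴ 1F = refl
inc⁴ 2F = refl
inc⁴ 3F = refl

rotate unrotate : Fin 4 → Fin 4 → Fin 4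
rotate 0F x = x
rotate 1F x = plus1 x
rotate 2F x = plus2 x
rotate 3F x = plus3 x
unrotate 0F x = x
unrotate 1F x = plus3 x
unrotate 2F x = plus2 x
unrotate 3F x = plus1 x

rotate-unrotate : ∀ t x → rotate t (unrotate t x) ≡ x
rotate-unrotate 0F x = refl
rotate-unrotate 1F x = inc⁴ x
rotate-unrotate 2F x = inc⁴ x
rotate-unrotate 3F x = inc⁴ x

unrotate-rotate : ∀ t x → unrotate t (rotate t x) ≡ x
unrotate-rotate 0F x = refl
unrotate-rotate 1F x = inc⁴ x
unrotate-rotate 2F x = inc⁴ x
unrotate-rotate 3F x = inc⁴ x

rotate-injective : ∀ t → Injective _≡_ _≡_ (rotate t)
rotate-injective t {x} {y} e =
  trans (sym (unrotate-rotate t x)) (trans (cong (unrotate t) e) (unrotate-rotate t y))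

rotate-zero : ∀ t → rotate t 0F ≡ t
rotate-zero 0F = refl
rotate-zero 1F = refl
rotate-zero 2F = refl
rotate-zero 3F = refl

rotate-inc : ∀ t x → rotate t (inc x) ≡ inc (rotate t x)
rotate-inc 0F x = refl
rotate-inc 1F x = refl
rotate-inc 2F x = refl
rotate-inc 3F x = refl

rotate-plus2 : ∀ t x → rotate t (plus2 x) ≡ plus2 (rotate t x)
rotate-plus2 t x = trans (rotate-inc t (inc x)) (cong inc (rotate-inc t x))

rotate-plus3 : ∀ t x → rotate t (plus3 x) ≡ plus3 (rotate t x)
rotate-plus3 t x = trans (rotate-inc t (plus2 x)) (cong inc (rotate-plus2 t x))

phase : GVertex n m → Fin 4
phase (_ , _ , x) = x

data Antipodal {n m : ℕ} : GVertex n m → GVertex n m → Set where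
  antipodal : ∀ {i j j' x y} → j ≢ j' → Antipodal (i , j , x) (i , j' , y)

antipodal? : (u v : GVertex n m) → Dec (Antipodal u v)
antipodal? (i , j , _) (i' , j' , _) with i ≟ i' | j ≟ j'
... | yes refl | no j≢j'  = yes (antipodal j≢j')
... | yes refl | yes refl = no λ { (antipodal j≢j) → j≢j refl }
... | no i≢i'  | _        = no λ { (antipodal _) → i≢i' refl }

antipodal-sym : {u v : GVertex n m} → Antipodal u v → Antipodal v u
antipodal-sym (antipodal j≢j') = antipodal (≢-sym j≢j')

module _ {T : Tournament n} {m : ℕ} where

  private
    _~_ : GVertex n m → GVertex n m → Set
    _~_ = GAdj T m

  ~-sym : ∀ {u v} → u ~ v → v ~ u
  ~-sym = swap

  parity≡⇔antipodal : ∀ {u v} → u ~ v → parity (phase u) ≡ parity (phase v) ⇔ Antipodal u v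
  parity≡⇔antipodal (inj₁ (e-cyc i j x)) =
    mk⇔ (⊥-elim ∘ parity-plus1 x) λ { (antipodal j≢j) → ⊥-elim (j≢j refl) }
  parity≡⇔antipodal (inj₁ (e-anti i j j' x j≢j')) =
    mk⇔ (const (antipodal j≢j')) (const (parity-plus2 x))
  parity≡⇔antipodal (inj₁ (e-arc i i' j j' x i⇒i')) =
    mk⇔ (⊥-elim ∘ parity-plus3 x) λ { (antipodal _) → ⊥-elim (irrefl T i i⇒i') }
  parity≡⇔antipodal (inj₂ (e-cyc i j x)) =
    mk⇔ (⊥-elim ∘ parity-plus1 x ∘ sym) λ { (antipodal j≢j) → ⊥-elim (j≢j refl) }
  parity≡⇔antipodal (inj₂ (e-anti i j j' x j≢j')) =
    mk⇔ (const (antipodal (≢-sym j≢j'))) (const (sym (parity-plus2 x)))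
  parity≡⇔antipodal (inj₂ (e-arc i i' j j' x i⇒i')) =
    mk⇔ (⊥-elim ∘ parity-plus3 x ∘ sym) λ { (antipodal _) → ⊥-elim (irrefl T i i⇒i') }

  antipodal-phase : ∀ {u v} → u ~ v → Antipodal u v → phase v ≡ plus2 (phase u)
  antipodal-phase (inj₁ (e-cyc i j x)) (antipodal j≢j) = ⊥-elim (j≢j refl)
  antipodal-phase (inj₁ (e-anti i j j' x _)) _ = refl
  antipodal-phase (inj₁ (e-arc i i' j j' x i⇒i)) (antipodal _) = ⊥-elim (irrefl T i i⇒i)
  antipodal-phase (inj₂ (e-cyc i j x)) (antipodal j≢j) = ⊥-elim (j≢j refl)
  antipodal-phase (inj₂ (e-anti i j j' x _)) _ = sym (inc⁴ x)
  antipodal-phase (inj₂ (e-arc i i' j j' x i⇒i)) (antipodal _) = ⊥-elim (irrefl T i i⇒i)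

  arc-phase : ∀ {i j x i' j' y} → (i , j , x) ~ (i' , j' , y) → _⇒_ T i i' → y ≡ plus3 x
  arc-phase (inj₁ (e-cyc i j x)) i⇒i = ⊥-elim (irrefl T i i⇒i)
  arc-phase (inj₁ (e-anti i j j' x _)) i⇒i = ⊥-elim (irrefl T i i⇒i)
  arc-phase (inj₁ (e-arc i i' j j' x _)) _ = refl
  arc-phase (inj₂ (e-cyc i j x)) i⇒i = ⊥-elim (irrefl T i i⇒i)
  arc-phase (inj₂ (e-anti i j j' x _)) i⇒i = ⊥-elim (irrefl T i i⇒i)
  arc-phase (inj₂ (e-arc i i' j j' x i⇒i')) i'⇒i = ⊥-elim (asym T i i' i⇒i' i'⇒i)

  phases-differ : ∀ {u v} → u ~ v → phase u ≢ phase v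
  phases-differ {u} {v} u~v e with antipodal? u v
  ... | yes a = plus2-no-fixpoint (phase u) (trans e (antipodal-phase u~v a))
  ... | no ¬a = ¬a (to (parity≡⇔antipodal u~v) (cong parity e))

  -- Only antipodal edges preserve the parity of the phase, so a triangle has an odd number of them.
  antipodal-closed : ∀ {u v w} → u ~ v → v ~ w → u ~ w →
                     Antipodal u v → Antipodal v w → Antipodal u w
  antipodal-closed u~v v~w u~w uv vw = to (parity≡⇔antipodal u~w)
    (trans (from (parity≡⇔antipodal u~v) uv) (from (parity≡⇔antipodal v~w) vw))

  some-antipodal : ∀ {u v w} → u ~ v → v ~ w → u ~ w →
                   ¬ Antipodal u v → ¬ Antipodal v w → Antipodal u w
  some-antipodal u~v v~w u~w ¬uv ¬vw = to (parity≡⇔antipodal u~w)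
    (trans (¬-not (¬uv ∘ to (parity≡⇔antipodal u~v)))
           (trans (cong not (¬-not (¬vw ∘ to (parity≡⇔antipodal v~w)))) (not-involutive _)))

  -- The third vertex v of a triangle sees both ends of an antipodal edge u ~ w
  -- in the same way, which forces phase u ≡ phase w.
  lonely-antipodal : ∀ {u v w} → v ~ u → v ~ w → u ~ w → Antipodal u w →
                     ¬ Antipodal v u → ¬ Antipodal v w → ⊥
  lonely-antipodal {i , j , x} {i' , j' , y} v~u v~w u~w (antipodal j≢l) ¬vu ¬vw
    with i' ≟ i
  ... | yes refl = j≢l (trans (sym (same-copy ¬vu)) (same-copy ¬vw))
    where
    same-copy : ∀ {l z} → ¬ Antipodal (i , j' , y) (i , l , z) → j' ≡ l
    same-copy ¬a = decidable-stable (j' ≟ _) (¬a ∘ antipodal)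
  ... | no i'≢i with total T i' i i'≢i
  ...   | inj₁ i'⇒i =
    phases-differ u~w (trans (arc-phase v~u i'⇒i) (sym (arc-phase v~w i'⇒i)))
  ...   | inj₂ i⇒i' =
    phases-differ u~w (rotate-injective 3F (trans (sym (arc-phase (~-sym v~u) i⇒i'))
                                              (arc-phase (~-sym v~w) i⇒i')))

  triangleFree : TriangleFree (GVertex n m) _~_
  triangleFree u v w (u~v , v~w , u~w)
    with antipodal? u v | antipodal? v w | antipodal? u w
  ... | yes uv | yes vw | _ =
    phases-differ u~w (sym (trans (antipodal-phase v~w vw)
                                  (trans (cong plus2 (antipodal-phase u~v uv)) (inc⁴ (phase u)))))
  ... | yes uv | no ¬vw | yes uw = ¬vw (antipodal-closed (~-sym u~v) u~w v~w (antipodal-sym uv) uw)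
  ... | no ¬uv | yes vw | yes uw = ¬uv (antipodal-closed u~w (~-sym v~w) u~v uw (antipodal-sym vw))
  ... | no ¬uv | no ¬vw | no ¬uw = ¬uw (some-antipodal u~v v~w u~w ¬uv ¬vw)
  ... | yes uv | no ¬vw | no ¬uw =
    lonely-antipodal (~-sym u~w) (~-sym v~w) u~v uv (¬uw ∘ antipodal-sym) (¬vw ∘ antipodal-sym)
  ... | no ¬uv | yes vw | no ¬uw = lonely-antipodal u~v u~w v~w vw ¬uv ¬uw
  ... | no ¬uv | no ¬vw | yes uw = lonely-antipodal (~-sym u~v) v~w u~w uw (¬uv ∘ antipodal-sym) ¬vw

-- A set A of at most three vertices is listed as a triple a (repetitions allowed);
-- β marks which entries of a lie in B.
module _ {V : Set} (_~_ : V → V → Set) where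

  PairAdmissible : Vec V 3 → Vec Bool 3 → Fin 3 → Fin 3 → Set
  PairAdmissible a β r s =
    (lookup a r ≡ lookup a s → lookup β r ≡ lookup β s) ×
    (T (lookup β r) → T (lookup β s) → ¬ (lookup a r ~ lookup a s))

  Admissible : Vec V 3 → Vec Bool 3 → Set
  Admissible a β = ∀ r s → PairAdmissible a β r s

  Extension : Vec V 3 → Vec Bool 3 → V → Set
  Extension a β v = ∀ r → v ≢ lookup a r × (v ~ lookup a r ⇔ T (lookup β r))

  TripleExtension : Vec V 3 → Vec Bool 3 → Set
  TripleExtension a β = Admissible a β → ∃ (Extension a β)

record Embedding {V W : Set} (_~_ : V → V → Set) (_≈_ : W → W → Set) : Set where
  field
    embed     : V → W
    injective : Injective _≡_ _≡_ embed
    adjacent  : ∀ {u v} → u ~ v ⇔ embed u ≈ embed v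

module _ {V W : Set} {_~_ : V → V → Set} {_≈_ : W → W → Set} (φ : Embedding _~_ _≈_) where

  open Embedding φ

  tripleExtension-transfer : ∀ {a a' β} → (∀ r → embed (lookup a r) ≡ lookup a' r) →
                             TripleExtension _~_ a β → TripleExtension _≈_ a' β
  tripleExtension-transfer {a} {a'} {β} covers extend admissible' =
    embed v , λ r → distinct r , agrees r
    where
    admissible : Admissible _~_ a β
    admissible r s =
      (λ e → proj₁ (admissible' r s) (trans (sym (covers r)) (trans (cong embed e) (covers s)))) ,
      (λ βr βs ~rs →
         proj₂ (admissible' r s) βr βs (subst₂ _≈_ (covers r) (covers s) (to adjacent ~rs)))
    v = proj₁ (extend admissible)
    extension = proj₂ (extend admissible)
    distinct : ∀ r → embed v ≢ lookup a' r
    distinct r e = proj₁ (extension r) (injective (trans e (sym (covers r))))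
    agrees : ∀ r → embed v ≈ lookup a' r ⇔ T (lookup β r)
    agrees r rewrite sym (covers r) = proj₂ (extension r) ⇔-∘ ⇔-sym adjacent

module _ {V : Set} (_≟V_ : DecidableEquality V) {_~_ : V → V → Set} where

  open DecMembership _≟V_ using (_∈?_)

  asTriple : V → (A : List V) → length A ≤ 3 →
             Σ (Vec V 3) λ a → ∀ {x} → x ∈ A → ∃ λ r → x ≡ lookup a r
  asTriple v [] _ = (v ∷ v ∷ v ∷ []) , λ ()
  asTriple _ (x ∷ []) _ = (x ∷ x ∷ x ∷ []) , λ { (here e) → 0F , e }
  asTriple _ (x ∷ y ∷ []) _ =
    (x ∷ y ∷ y ∷ []) , λ { (here e) → 0F , e ; (there (here e)) → 1F , e }
  asTriple _ (x ∷ y ∷ z ∷ []) _ =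
    (x ∷ y ∷ z ∷ []) ,
    λ { (here e) → 0F , e ; (there (here e)) → 1F , e ; (there (there (here e))) → 2F , e }
  asTriple _ (_ ∷ _ ∷ _ ∷ _ ∷ _) (s≤s (s≤s (s≤s ())))

  tripleExtension⇒threeEC : V → (∀ a β → TripleExtension _~_ a β) → ThreeEC V _~_
  tripleExtension⇒threeEC v₀ extend A B |A|≤3 B⊆A independent =
    v , v∉A , All.tabulate adjacent , nonadjacent
    where
    a = proj₁ (asTriple v₀ A |A|≤3)
    listed = proj₂ (asTriple v₀ A |A|≤3)
    β = map (λ x → isYes (x ∈? B)) a
    member : ∀ r → T (lookup β r) ⇔ lookup a r ∈ B
    member r rewrite lookup-map r (λ x → isYes (x ∈? B)) a = mk⇔ toWitness fromWitness
    admissible : Admissible _~_ a β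
    admissible r s =
      (λ e → trans (lookup-map r _ a) (trans (cong (λ x → isYes (x ∈? B)) e) (sym (lookup-map s _ a)))) ,
      (λ βr βs → independent _ _ (to (member r) βr) (to (member s) βs))
    v = proj₁ (extend a β admissible)
    extension = proj₂ (extend a β admissible)
    v∉A : v ∉ A
    v∉A v∈A = let r , e = listed v∈A in proj₁ (extension r) e
    adjacent : ∀ {b} → b ∈ B → v ~ b
    adjacent b∈B with listed (All.lookup B⊆A b∈B)
    ... | r , refl = from (proj₂ (extension r)) (from (member r) b∈B)
    nonadjacent : ∀ x → x ∈ A → x ∉ B → ¬ (v ~ x)
    nonadjacent x x∈A x∉B v~x with listed x∈A
    ... | r , refl = x∉B (to (member r) (to (proj₂ (extension r)) v~x))

IsTournamentEmbedding : Tournament c → Tournament n → (Fin c → Fin n) → Set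
IsTournamentEmbedding S T g = Injective _≡_ _≡_ g × (∀ i j → _⇒_ S i j ⇔ _⇒_ T (g i) (g j))

liftEmbedding : {S : Tournament c} {T : Tournament n} {g : Fin c → Fin n} → IsTournamentEmbedding S T g →
                (h : Fin c → Fin k → Fin m) → (∀ w → Injective _≡_ _≡_ (h w)) →
                Fin 4 → Embedding (GAdj S k) (GAdj T m)
liftEmbedding {c} {n} {k} {m} {S} {T} {g} (g-injective , arcs) h h-injective t = record
  { embed     = embed
  ; injective = injective
  ; adjacent  = λ {u} {v} → edge⇔ u v ⊎-⇔ edge⇔ v u
  }
  where
  embed : GVertex c k → GVertex n m
  embed (w , q , y) = g w , h w q , rotate t y

  injective : Injective _≡_ _≡_ embed
  injective {w , _} e with ,-injective e
  ... | gw≡gw' , e' with g-injective gw≡gw' | ,-injective e'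
  ...   | refl | hq≡hq' , ty≡ty' =
    cong (w ,_) (cong₂ _,_ (h-injective w hq≡hq') (rotate-injective t ty≡ty'))

  phase⇔ : ∀ {f : Fin 4 → Fin 4} → (∀ x → rotate t (f x) ≡ f (rotate t x)) →
           ∀ {x y} → y ≡ f x ⇔ rotate t y ≡ f (rotate t x)
  phase⇔ commutes {x} =
    mk⇔ (λ { refl → commutes x }) (λ e → rotate-injective t (trans e (sym (commutes x))))

  shape→ : ∀ u v → EdgeShape S k u v → EdgeShape T m (embed u) (embed v)
  shape→ (w , q , x) (_ , _ , _) (inj₁ (refl , refl , e)) =
    inj₁ (refl , refl , to (phase⇔ (rotate-inc t)) e)
  shape→ (w , q , x) (_ , _ , _) (inj₂ (inj₁ (refl , q≢q' , e))) =
    inj₂ (inj₁ (refl , q≢q' ∘ h-injective w , to (phase⇔ (rotate-plus2 t)) e))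
  shape→ (w , q , x) (w' , _ , _) (inj₂ (inj₂ (w⇒w' , e))) =
    inj₂ (inj₂ (to (arcs w w') w⇒w' , to (phase⇔ (rotate-plus3 t)) e))

  shape← : ∀ u v → EdgeShape T m (embed u) (embed v) → EdgeShape S k u v
  shape← (w , q , x) (w' , q' , y) (inj₁ (gw≡gw' , hq≡hq' , e)) with g-injective gw≡gw'
  ... | refl = inj₁ (refl , h-injective w hq≡hq' , from (phase⇔ (rotate-inc t)) e)
  shape← (w , q , x) (w' , q' , y) (inj₂ (inj₁ (gw≡gw' , hq≢hq' , e))) with g-injective gw≡gw'
  ... | refl = inj₂ (inj₁ (refl , hq≢hq' ∘ cong (h w) , from (phase⇔ (rotate-plus2 t)) e))
  shape← (w , q , x) (w' , q' , y) (inj₂ (inj₂ (gw⇒gw' , e))) =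
    inj₂ (inj₂ (from (arcs w w') gw⇒gw' , from (phase⇔ (rotate-plus3 t)) e))

  edge⇔ : ∀ u v → GEdge S k u v ⇔ GEdge T m (embed u) (embed v)
  edge⇔ u v = edgeShape⇔GEdge {u = embed u}
          ⇔-∘ (mk⇔ (shape→ u v) (shape← u v) ⇔-∘ ⇔-sym (edgeShape⇔GEdge {u = u}))

T₄ : Tournament 4
T₄ = record { _⇒_ = T4arc ; irrefl = λ _ () ; asym = asym₄ ; total = total₄ }
  where
  asym₄ : ∀ i j → T4arc i j → ¬ T4arc j i
  asym₄ _ _ a01 ()
  asym₄ _ _ a02 ()
  asym₄ _ _ a03 ()
  asym₄ _ _ a12 ()
  asym₄ _ _ a23 ()
  asym₄ _ _ a31 ()
  total₄ : ∀ i j → i ≢ j → T4arc i j ⊎ T4arc j i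
  total₄ 0F 1F _ = inj₁ a01
  total₄ 0F 2F _ = inj₁ a02
  total₄ 0F 3F _ = inj₁ a03
  total₄ 1F 0F _ = inj₂ a01
  total₄ 1F 2F _ = inj₁ a12
  total₄ 1F 3F _ = inj₂ a31
  total₄ 2F 0F _ = inj₂ a02
  total₄ 2F 1F _ = inj₂ a12
  total₄ 2F 3F _ = inj₁ a23
  total₄ 3F 0F _ = inj₂ a03
  total₄ 3F 1F _ = inj₁ a31
  total₄ 3F 2F _ = inj₂ a23
  total₄ 0F 0F 0≢0 = ⊥-elim (0≢0 refl)
  total₄ 1F 1F 1≢1 = ⊥-elim (1≢1 refl)
  total₄ 2F 2F 2≢2 = ⊥-elim (2≢2 refl)
  total₄ 3F 3F 3≢3 = ⊥-elim (3≢3 refl)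

reverse : Tournament n → Tournament n
reverse T = record
  { _⇒_    = λ i j → _⇒_ T j i
  ; irrefl = irrefl T
  ; asym   = λ i j → asym T j i
  ; total  = λ i j i≢j → total T j i (≢-sym i≢j)
  }

T₄′ : Tournament 4
T₄′ = reverse T₄

transitive : (n : ℕ) → Tournament n
transitive n = record { _⇒_ = _<_ ; irrefl = λ _ → <-irrefl refl ; asym = λ _ _ → <-asym ; total = total< }
  where
  total< : ∀ i j → i ≢ j → i < j ⊎ j < i
  total< i j i≢j with <-cmp i j
  ... | tri< i<j _ _ = inj₁ i<j
  ... | tri≈ _ i≡j _ = ⊥-elim (i≢j i≡j)
  ... | tri> _ _ j<i = inj₂ j<i

lookup-pair-injective : {A : Set} {s t : A} → s ≢ t → Injective _≡_ _≡_ (lookup (s ∷ t ∷ []))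
lookup-pair-injective s≢t = lookup-injective ((s≢t ∷ []) ∷ [] ∷ []) _ _

unique? : (xs : Vec (Fin c) n) → Dec (Unique xs)
unique? = allPairs? λ x y → ¬? (x ≟ y)

unique-preimage : {A B : Set} {f : A → B} {xs : Vec A n} {ys : Vec B n} →
                  Unique ys → (∀ r → f (lookup xs r) ≡ lookup ys r) → Unique xs
unique-preimage {f = f} {xs} unique covers = subst Unique (tabulate∘lookup xs) (tabulate⁺ λ {r} {s} e →
  lookup-injective unique r s (trans (sym (covers r)) (trans (cong f e) (covers s))))

arcEmbedding : {T : Tournament n} {s t : Fin n} → _⇒_ T s t →
               IsTournamentEmbedding (transitive 2) T (lookup (s ∷ t ∷ []))
arcEmbedding {T = T} {s} {t} s⇒t = lookup-pair-injective (λ { refl → irrefl T s s⇒t }) , arcs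
  where
  arcs : ∀ i j → i < j ⇔ _⇒_ T (lookup (s ∷ t ∷ []) i) (lookup (s ∷ t ∷ []) j)
  arcs 0F 0F = mk⇔ (λ ()) (⊥-elim ∘ irrefl T s)
  arcs 0F 1F = mk⇔ (const s⇒t) (const z<s)
  arcs 1F 0F = mk⇔ (λ ()) (⊥-elim ∘ asym T s t s⇒t)
  arcs 1F 1F = mk⇔ (λ { (s≤s ()) }) (⊥-elim ∘ irrefl T t)

-- Copy labels numbered in order of first appearance.
data Canonical : (k : ℕ) → Vec (Fin k) 3 → Set where
  twoCopies   : ∀ q₁ q₂ → Canonical 2 (0F ∷ q₁ ∷ q₂ ∷ [])
  threeCopies : Canonical 3 (0F ∷ 1F ∷ 2F ∷ [])

-- Positions p in S and copy labels q of three vertices of G_S(k), in the cases checked by computation.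
data Configuration : {c : ℕ} → Tournament c → (k : ℕ) → Vec (Fin c) 3 → Vec (Fin k) 3 → Set₁ where
  inT₄  : ∀ {p} → Unique p → Configuration T₄ 2 p (0F ∷ 0F ∷ 0F ∷ [])
  inT₄′ : ∀ {p} → Unique p → Configuration T₄′ 2 p (0F ∷ 0F ∷ 0F ∷ [])
  onArc : ∀ {k} p {q} → Canonical k q → Configuration (transitive 2) k p q

vertices : Vec (Fin c) 3 → Vec (Fin k) 3 → Vec (Fin 4) 3 → Vec (GVertex c k) 3
vertices p q x = zipWith _,_ p (zipWith _,_ q x)

lookup-vertices : ∀ (p : Vec (Fin c) 3) (q : Vec (Fin k) 3) x r →
                  lookup (vertices p q x) r ≡ (lookup p r , lookup q r , lookup x r)
lookup-vertices p q x r =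
  trans (lookup-zipWith _,_ r p _) (cong (lookup p r ,_) (lookup-zipWith _,_ r q x))

-- Opaque, so that unification treats the quantifiers as rigid heads.
opaque
  ∀ᶠ ∃ᶠ : (Fin k → Bool) → Bool
  ∀ᶠ f = all f (allFin _)
  ∃ᶠ f = any f (allFin _)

  ∀ᴮ : (Bool → Bool) → Bool
  ∀ᴮ f = f true ∧ f false

  ∀ᶠ-sound : {f : Fin k → Bool} → ∀ᶠ f ≡ true → ∀ i → f i ≡ true
  ∀ᶠ-sound {f = f} h i = to T-≡ (All.lookup (all⁺ f (allFin _) (from T-≡ h)) (∈-allFin i))

  ∀ᶠ-complete : {f : Fin k → Bool} → (∀ i → f i ≡ true) → ∀ᶠ f ≡ true
  ∀ᶠ-complete {f = f} h = to T-≡ (all⁻ f {allFin _} (All.tabulate λ {i} _ → from T-≡ (h i)))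

  ∃ᶠ-sound : {f : Fin k → Bool} → ∃ᶠ f ≡ true → ∃ λ i → f i ≡ true
  ∃ᶠ-sound {f = f} h = let i , fi = satisfied (any⁻ f (allFin _) (from T-≡ h)) in i , to T-≡ fi

  ∀ᴮ-sound : {f : Bool → Bool} → ∀ᴮ f ≡ true → ∀ b → f b ≡ true
  ∀ᴮ-sound {f} h true = ∧-conicalˡ (f true) (f false) h
  ∀ᴮ-sound {f} h false = ∧-conicalʳ (f true) (f false) h

then-sound : ∀ {b s} → b ≡ true → (if b then s else true) ≡ true → s ≡ true
then-sound refl h = h

yes-sound : {P : Set} (d : Dec P) → does d ≡ true → P
yes-sound (yes p) _ = p

does⇔T : ∀ {P : Set} {b} (d : Dec P) → does d ≡ b → P ⇔ T b
does⇔T (yes p) refl = mk⇔ (const _) (const p)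
does⇔T (no ¬p) refl = mk⇔ ¬p λ ()

∀canonicalᵇ : ∀ k → (Vec (Fin k) 3 → Bool) → Bool
∀canonicalᵇ 2 f = ∀ᶠ λ q₁ → ∀ᶠ λ q₂ → f (0F ∷ q₁ ∷ q₂ ∷ [])
∀canonicalᵇ 3 f = f (0F ∷ 1F ∷ 2F ∷ [])
∀canonicalᵇ _ _ = true

∀canonicalᵇ-sound : ∀ {f q} → ∀canonicalᵇ k f ≡ true → Canonical k q → f q ≡ true
∀canonicalᵇ-sound h (twoCopies q₁ q₂) = ∀ᶠ-sound (∀ᶠ-sound h q₁) q₂
∀canonicalᵇ-sound h threeCopies = h

module LocalCheck {c : ℕ} (S : Tournament c) (k : ℕ) where

  private
    V : Set
    V = GVertex c k
    _~_ : V → V → Set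
    _~_ = GAdj S k

  pairAdmissible? : ∀ a β r s → Dec (PairAdmissible _~_ a β r s)
  pairAdmissible? a β r s =
    (lookup a r ≟ᵛ lookup a s →-dec lookup β r ≟ᴮ lookup β s) ×-dec
    (T? (lookup β r) →-dec T? (lookup β s) →-dec ¬? (GAdj? S k (lookup a r) (lookup a s)))

  agrees? : ∀ (a : Vec V 3) (β : Vec Bool 3) v r →
    Dec (v ≢ lookup a r × does (GAdj? S k v (lookup a r)) ≡ lookup β r)
  agrees? a β v r = ¬? (v ≟ᵛ lookup a r) ×-dec does (GAdj? S k v (lookup a r)) ≟ᴮ lookup β r

  tripleExtensionᵇ : Vec V 3 → Vec Bool 3 → Bool
  tripleExtensionᵇ a β =
    if (∀ᶠ λ r → ∀ᶠ λ s → does (pairAdmissible? a β r s))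
    then (∃ᶠ λ w → ∃ᶠ λ q → ∃ᶠ λ y → ∀ᶠ λ r → does (agrees? a β (w , q , y) r))
    else true

  tripleExtensionᵇ-sound : ∀ a β → tripleExtensionᵇ a β ≡ true → TripleExtension _~_ a β
  tripleExtensionᵇ-sound a β h admissible = witness (∃ᶠ-sound found)
    where
    found : (∃ᶠ λ w → ∃ᶠ λ q → ∃ᶠ λ y → ∀ᶠ λ r → does (agrees? a β (w , q , y) r)) ≡ true
    found = then-sound
      (∀ᶠ-complete λ r → ∀ᶠ-complete λ s → dec-true (pairAdmissible? a β r s) (admissible r s)) h
    extension : ∀ {v} → (∀ᶠ λ r → does (agrees? a β v r)) ≡ true → Extension _~_ a β v
    extension {v} agree r =
      let v≢ar , adjacency = yes-sound (agrees? a β v r) (∀ᶠ-sound agree r)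
      in v≢ar , does⇔T (GAdj? S k v (lookup a r)) adjacency
    witness : (∃ λ w → (∃ᶠ λ q → ∃ᶠ λ y → ∀ᶠ λ r → does (agrees? a β (w , q , y) r)) ≡ true) →
              ∃ (Extension _~_ a β)
    witness (w , found-w) with ∃ᶠ-sound found-w
    ... | q , found-q with ∃ᶠ-sound found-q
    ...   | y , agree = (w , q , y) , extension agree

  -- The first vertex sits at phase 0, since liftedModel rotates the phases.
  allPhasesᵇ : Vec (Fin c) 3 → Vec (Fin k) 3 → Bool
  allPhasesᵇ p q = ∀ᶠ λ x₁ → ∀ᶠ λ x₂ → ∀ᴮ λ b₀ → ∀ᴮ λ b₁ → ∀ᴮ λ b₂ →
    tripleExtensionᵇ (vertices p q (0F ∷ x₁ ∷ x₂ ∷ [])) (b₀ ∷ b₁ ∷ b₂ ∷ [])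

  allPhasesᵇ-sound : ∀ {p q} → allPhasesᵇ p q ≡ true →
    ∀ x₁ x₂ β → TripleExtension _~_ (vertices p q (0F ∷ x₁ ∷ x₂ ∷ [])) β
  allPhasesᵇ-sound {p} {q} h x₁ x₂ β@(b₀ ∷ b₁ ∷ b₂ ∷ []) =
    tripleExtensionᵇ-sound (vertices p q (0F ∷ x₁ ∷ x₂ ∷ [])) β
      (∀ᴮ-sound (∀ᴮ-sound (∀ᴮ-sound (∀ᶠ-sound (∀ᶠ-sound h x₁) x₂) b₀) b₁) b₂)

  distinctPositionsᵇ : Vec (Fin k) 3 → Bool
  distinctPositionsᵇ q = ∀ᶠ λ p₀ → ∀ᶠ λ p₁ → ∀ᶠ λ p₂ →
    if does (unique? (p₀ ∷ p₁ ∷ p₂ ∷ [])) then allPhasesᵇ (p₀ ∷ p₁ ∷ p₂ ∷ []) q else true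

  distinctPositionsᵇ-sound : ∀ {q} → distinctPositionsᵇ q ≡ true → ∀ {p} → Unique p →
    ∀ x₁ x₂ β → TripleExtension _~_ (vertices p q (0F ∷ x₁ ∷ x₂ ∷ [])) β
  distinctPositionsᵇ-sound {q} h {p@(p₀ ∷ p₁ ∷ p₂ ∷ [])} unique = allPhasesᵇ-sound {p} {q}
    (then-sound (dec-true (unique? p) unique) (∀ᶠ-sound (∀ᶠ-sound (∀ᶠ-sound h p₀) p₁) p₂))

  allPositionsᵇ : Bool
  allPositionsᵇ = ∀ᶠ λ p₀ → ∀ᶠ λ p₁ → ∀ᶠ λ p₂ → ∀canonicalᵇ k (allPhasesᵇ (p₀ ∷ p₁ ∷ p₂ ∷ []))

  allPositionsᵇ-sound : allPositionsᵇ ≡ true → ∀ {p q} → Canonical k q →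
    ∀ x₁ x₂ β → TripleExtension _~_ (vertices p q (0F ∷ x₁ ∷ x₂ ∷ [])) β
  allPositionsᵇ-sound h {p₀ ∷ p₁ ∷ p₂ ∷ []} {q} canonical =
    allPhasesᵇ-sound {p₀ ∷ p₁ ∷ p₂ ∷ []} {q}
      (∀canonicalᵇ-sound (∀ᶠ-sound (∀ᶠ-sound (∀ᶠ-sound h p₀) p₁) p₂) canonical)

opaque
  unfolding ∀ᶠ

  T₄-checked : LocalCheck.distinctPositionsᵇ T₄ 2 (0F ∷ 0F ∷ 0F ∷ []) ≡ true
  T₄-checked = refl

  T₄′-checked : LocalCheck.distinctPositionsᵇ T₄′ 2 (0F ∷ 0F ∷ 0F ∷ []) ≡ true
  T₄′-checked = refl

  arc-twoCopies-checked : LocalCheck.allPositionsᵇ (transitive 2) 2 ≡ true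
  arc-twoCopies-checked = refl

  arc-threeCopies-checked : LocalCheck.allPositionsᵇ (transitive 2) 3 ≡ true
  arc-threeCopies-checked = refl

configurationExtension : {S : Tournament c} {p : Vec (Fin c) 3} {q : Vec (Fin k) 3} →
                         Configuration S k p q →
                         ∀ x₁ x₂ β → TripleExtension (GAdj S k) (vertices p q (0F ∷ x₁ ∷ x₂ ∷ [])) β
configurationExtension (inT₄ unique) =
  LocalCheck.distinctPositionsᵇ-sound T₄ 2 {0F ∷ 0F ∷ 0F ∷ []} T₄-checked unique
configurationExtension (inT₄′ unique) =
  LocalCheck.distinctPositionsᵇ-sound T₄′ 2 {0F ∷ 0F ∷ 0F ∷ []} T₄′-checked unique
configurationExtension (onArc p canonical@(twoCopies _ _)) =
  LocalCheck.allPositionsᵇ-sound (transitive 2) 2 arc-twoCopies-checked {p} canonical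
configurationExtension (onArc p canonical@threeCopies) =
  LocalCheck.allPositionsᵇ-sound (transitive 2) 3 arc-threeCopies-checked {p} canonical

data Shape {A : Set} : Vec A 3 → Set where
  pairwiseDistinct : ∀ {xs} → Unique xs → Shape xs
  withinPair       : ∀ {x₀ x₁ x₂} u → x₀ ≢ u → x₁ ≡ x₀ ⊎ x₁ ≡ u → x₂ ≡ x₀ ⊎ x₂ ≡ u →
                     Shape (x₀ ∷ x₁ ∷ x₂ ∷ [])

other : Fin (suc (suc n)) → Fin (suc (suc n))
other zero = 1F
other (suc _) = 0F

other-≢ : (x : Fin (suc (suc n))) → other x ≢ x
other-≢ zero ()
other-≢ (suc _) ()

shape : (xs : Vec (Fin (suc (suc n))) 3) → Shape xs
shape (x₀ ∷ x₁ ∷ x₂ ∷ []) with x₀ ≟ x₁ | x₀ ≟ x₂ | x₁ ≟ x₂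
... | no x₀≢x₁ | no x₀≢x₂ | no x₁≢x₂ =
  pairwiseDistinct ((x₀≢x₁ ∷ x₀≢x₂ ∷ []) ∷ (x₁≢x₂ ∷ []) ∷ [] ∷ [])
... | no x₀≢x₁ | no _     | yes refl = withinPair x₁ x₀≢x₁ (inj₂ refl) (inj₂ refl)
... | no x₀≢x₁ | yes refl | _        = withinPair x₁ x₀≢x₁ (inj₂ refl) (inj₁ refl)
... | yes refl | no x₀≢x₂ | _        = withinPair x₂ x₀≢x₂ (inj₁ refl) (inj₂ refl)
... | yes refl | yes refl | _        = withinPair (other x₀) (≢-sym (other-≢ x₀)) (inj₁ refl) (inj₁ refl)

side : {A : Set} {x s t : A} → x ≡ s ⊎ x ≡ t → Fin 2
side (inj₁ _) = 0F
side (inj₂ _) = 1F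

lookup-side : {A : Set} {x s t : A} (e : x ≡ s ⊎ x ≡ t) → lookup (s ∷ t ∷ []) (side e) ≡ x
lookup-side (inj₁ refl) = refl
lookup-side (inj₂ refl) = refl

record CopyCover {m : ℕ} (js : Vec (Fin m) 3) : Set where
  field
    copies         : ℕ
    copy           : Fin copies → Fin m
    copy-injective : Injective _≡_ _≡_ copy
    label          : Vec (Fin copies) 3
    canonical      : Canonical copies label
    label-covers   : ∀ r → copy (lookup label r) ≡ lookup js r

copyCover : {js : Vec (Fin m) 3} → Shape js → CopyCover js
copyCover (pairwiseDistinct {js} unique) = record
  { copy           = lookup js
  ; copy-injective = lookup-injective unique _ _
  ; label          = 0F ∷ 1F ∷ 2F ∷ []
  ; canonical      = threeCopies
  ; label-covers   = λ { 0F → refl ; 1F → refl ; 2F → refl }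
  }
copyCover (withinPair {j₀} u j₀≢u e₁ e₂) = record
  { copy           = lookup (j₀ ∷ u ∷ [])
  ; copy-injective = lookup-pair-injective j₀≢u
  ; label          = 0F ∷ side e₁ ∷ side e₂ ∷ []
  ; canonical      = twoCopies (side e₁) (side e₂)
  ; label-covers   = λ { 0F → refl ; 1F → lookup-side e₁ ; 2F → lookup-side e₂ }
  }

assign : {A : Set} → Vec (Fin c) 3 → Vec A 3 → Vec A c → Vec A c
assign (k₀ ∷ k₁ ∷ k₂ ∷ []) (y₀ ∷ y₁ ∷ y₂ ∷ []) zs = zs [ k₀ ]≔ y₀ [ k₁ ]≔ y₁ [ k₂ ]≔ y₂

lookup-assign : {A : Set} {ks : Vec (Fin c) 3} → Unique ks → ∀ (ys : Vec A 3) zs r →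
                lookup (assign ks ys zs) (lookup ks r) ≡ lookup ys r
lookup-assign {ks = k₀ ∷ k₁ ∷ k₂ ∷ []} ((k₀≢k₁ ∷ k₀≢k₂ ∷ []) ∷ (k₁≢k₂ ∷ []) ∷ [] ∷ []) (y₀ ∷ y₁ ∷ y₂ ∷ []) zs
  = λ { 0F → trans (lookup∘update′ k₀≢k₂ zs₁ y₂) (trans (lookup∘update′ k₀≢k₁ zs₀ y₁) (lookup∘update k₀ zs y₀))
      ; 1F → trans (lookup∘update′ k₁≢k₂ zs₁ y₂) (lookup∘update k₁ zs₀ y₁)
      ; 2F → lookup∘update k₂ zs₁ y₂ }
  where
  zs₀ = zs [ k₀ ]≔ y₀
  zs₁ = zs₀ [ k₁ ]≔ y₁

record LocalModel (T : Tournament n) (m : ℕ) (a : Vec (GVertex n m) 3) : Set₁ where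
  field
    size copies   : ℕ
    frame         : Tournament size
    position      : Vec (Fin size) 3
    label         : Vec (Fin copies) 3
    configuration : Configuration frame copies position label
    phase₁ phase₂ : Fin 4
    embedding     : Embedding (GAdj frame copies) (GAdj T m)
    covers        : ∀ r → Embedding.embed embedding
                            (lookup (vertices position label (0F ∷ phase₁ ∷ phase₂ ∷ [])) r) ≡ lookup a r

module _ {T : Tournament n} {m : ℕ} where

  liftedModel : {S : Tournament c} {g : Fin c → Fin n} → IsTournamentEmbedding S T g →
    (h : Fin c → Fin k → Fin m) → (∀ w → Injective _≡_ _≡_ (h w)) →
    ∀ {p q is js} → Configuration S k p q →
    (∀ r → g (lookup p r) ≡ lookup is r) → (∀ r → h (lookup p r) (lookup q r) ≡ lookup js r) →
    ∀ xs → LocalModel T m (vertices is js xs)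
  liftedModel {c} {k} {S} {g} embeds h h-injective {p} {q} {is} {js} configuration g-covers h-covers
              xs@(x₀ ∷ x₁ ∷ x₂ ∷ []) = record
    { size = c ; copies = k ; frame = S ; position = p ; label = q ; configuration = configuration
    ; phase₁ = unrotate x₀ x₁ ; phase₂ = unrotate x₀ x₂
    ; embedding = φ
    ; covers = covers
    }
    where
    φ : Embedding (GAdj S k) (GAdj T m)
    φ = liftEmbedding {S = S} {T = T} embeds h h-injective x₀
    ys = 0F ∷ unrotate x₀ x₁ ∷ unrotate x₀ x₂ ∷ []
    phases-cover : ∀ r → rotate x₀ (lookup ys r) ≡ lookup xs r
    phases-cover 0F = rotate-zero x₀
    phases-cover 1F = rotate-unrotate x₀ x₁
    phases-cover 2F = rotate-unrotate x₀ x₂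
    covers : ∀ r → Embedding.embed φ (lookup (vertices p q ys) r) ≡ lookup (vertices is js xs) r
    covers r rewrite lookup-vertices p q ys r | lookup-vertices is js xs r =
      cong₂ _,_ (g-covers r) (cong₂ _,_ (h-covers r) (phases-cover r))

  arcModel : {s t : Fin n} → _⇒_ T s t →
    ∀ {i₀ i₁ i₂} → i₀ ≡ s ⊎ i₀ ≡ t → i₁ ≡ s ⊎ i₁ ≡ t → i₂ ≡ s ⊎ i₂ ≡ t →
    {js : Vec (Fin m) 3} → CopyCover js → ∀ xs → LocalModel T m (vertices (i₀ ∷ i₁ ∷ i₂ ∷ []) js xs)
  arcModel {s} {t} s⇒t {i₀} {i₁} {i₂} e₀ e₁ e₂ cover =
    liftedModel (arcEmbedding {T = T} s⇒t) (λ _ → copy) (λ _ → copy-injective)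
      (onArc (side e₀ ∷ side e₁ ∷ side e₂ ∷ []) canonical) sides label-covers
    where
    open CopyCover cover
    sides : ∀ r → lookup (s ∷ t ∷ []) (lookup (side e₀ ∷ side e₁ ∷ side e₂ ∷ []) r)
                  ≡ lookup (i₀ ∷ i₁ ∷ i₂ ∷ []) r
    sides 0F = lookup-side e₀
    sides 1F = lookup-side e₁
    sides 2F = lookup-side e₂

module _ {T : Tournament n} {m : ℕ} where

  -- In each column of T₄ (or T₄′) copy 0 is the copy of the given vertex in that column, if any.
  distinctColumnsModel : {S : Tournament 4} {f : Fin 4 → Fin n} → IsTournamentEmbedding S T f →
    (∀ {ks} → Unique ks → Configuration S 2 ks (0F ∷ 0F ∷ 0F ∷ [])) →
    ∀ {is} → Unique is → ∀ ks → (∀ r → f (lookup ks r) ≡ lookup is r) →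
    ∀ js xs → LocalModel T (suc (suc m)) (vertices is js xs)
  distinctColumnsModel {f = f} embeds inS is-unique ks covers js@(j₀ ∷ _) =
    liftedModel embeds h (λ w → lookup-pair-injective (≢-sym (other-≢ (anchor w))))
      (inS ks-unique) covers (λ { 0F → anchored 0F ; 1F → anchored 1F ; 2F → anchored 2F })
    where
    ks-unique = unique-preimage {f = f} {ks} is-unique covers
    anchor : Fin 4 → Fin (suc (suc m))
    anchor = lookup (assign ks js (replicate 4 j₀))
    anchored : ∀ r → anchor (lookup ks r) ≡ lookup js r
    anchored = lookup-assign ks-unique js (replicate 4 j₀)
    h : Fin 4 → Fin 2 → Fin (suc (suc m))
    h w = lookup (anchor w ∷ other (anchor w) ∷ [])

  localModel : Shattered T → ∀ {is} → Shape is → ∀ js xs → LocalModel T (suc (suc m)) (vertices is js xs)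
  localModel shattered (pairwiseDistinct unique@((i₀≢i₁ ∷ i₀≢i₂ ∷ []) ∷ (i₁≢i₂ ∷ []) ∷ [] ∷ [])) js xs
    with shattered _ _ _ i₀≢i₁ i₁≢i₂ i₀≢i₂
  ... | f , inj₁ embeds , (k₀ , e₀) , (k₁ , e₁) , (k₂ , e₂) =
    distinctColumnsModel embeds inT₄ unique (k₀ ∷ k₁ ∷ k₂ ∷ []) (λ { 0F → e₀ ; 1F → e₁ ; 2F → e₂ }) js xs
  ... | f , inj₂ embeds , (k₀ , e₀) , (k₁ , e₁) , (k₂ , e₂) =
    distinctColumnsModel embeds inT₄′ unique (k₀ ∷ k₁ ∷ k₂ ∷ []) (λ { 0F → e₀ ; 1F → e₁ ; 2F → e₂ }) js xs
  localModel _ (withinPair u i₀≢u e₁ e₂) js xs with total T _ u i₀≢u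
  ... | inj₁ i₀⇒u = arcModel i₀⇒u (inj₁ refl) e₁ e₂ (copyCover (shape js)) xs
  ... | inj₂ u⇒i₀ = arcModel u⇒i₀ (inj₂ refl) (swap e₁) (swap e₂) (copyCover (shape js)) xs

tripleExtension : {T : Tournament n} → Shattered T → 2 ≤ n →
                  ∀ a β → TripleExtension (GAdj T (suc (suc m))) a β
tripleExtension {T = T} shattered (s≤s (s≤s z≤n)) a@((i₀ , j₀ , x₀) ∷ (i₁ , j₁ , x₁) ∷ (i₂ , j₂ , x₂) ∷ []) β =
  tripleExtension-transfer embedding {vertices position label (0F ∷ phase₁ ∷ phase₂ ∷ [])} {a} {β} covers
    (configurationExtension configuration phase₁ phase₂ β)
  where
  open LocalModel
    (localModel {T = T} shattered (shape (i₀ ∷ i₁ ∷ i₂ ∷ [])) (j₀ ∷ j₁ ∷ j₂ ∷ []) (x₀ ∷ x₁ ∷ x₂ ∷ []))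

corollary11 : ∀ (n : ℕ) (T : Tournament n) (m : ℕ) → 2 ≤ n → Shattered T → 2 ≤ m →
    ThreeECTriangleFree (GVertex n m) (GAdj T m)
corollary11 n T (suc (suc m)) 2≤n shattered (s≤s (s≤s z≤n)) =
  triangleFree , tripleExtension⇒threeEC _≟ᵛ_ (vertex₀ 2≤n) (tripleExtension shattered 2≤n)
  where
  vertex₀ : 2 ≤ n → GVertex n (suc (suc m))
  vertex₀ (s≤s _) = 0F , 0F , 0F
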